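{- Let $K$ be a field of characteristic not $2$ and define $\sigma(k)=\frac{1-k}{1+k}$. Then $\sigma$ is an involution of $T_K$ (a bijection $T_K\to T_K$ with $\sigma\circ\sigma=\mathrm{id}$), and for all $k_1,k_2\in T_K$ we have $\sigma(k_2)\overset{k}{\mapsto}\sigma(k_1)$ if and only if $k_1\overset{k}{\mapsto}k_2$.
   Context: $T_K=K\setminus\{0,1,-1\}$. For $k_1,k_2\in T_K$ write $k_1\overset{k}{\mapsto}k_2$ if $(1+k_1)^2k_2^2=4k_1$. -}

module Defs where

open import Level using (Level; _⊔_) renaming (suc to lsuc)
open import Algebra.Bundles using (CommutativeRing)
open import Relation.Nullary using (¬_)
open import Data.Product using (_×_)

-- The inverse is a total operation whose
-- value at 0 is unspecified (only used at nonzero arguments).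
record Field (c ℓ : Level) : Set (lsuc (c ⊔ ℓ)) where
  field
    commutativeRing : CommutativeRing c ℓ
  open CommutativeRing commutativeRing public
  field
    0≉1      : ¬ (0# ≈ 1#)
    _⁻¹      : Carrier → Carrier
    ⁻¹-inverseʳ : ∀ x → ¬ (x ≈ 0#) → x * (x ⁻¹) ≈ 1#

module FieldDefs {c ℓ : Level} (K : Field c ℓ) where
  open Field K

  CharNot2 : Set ℓ
  CharNot2 = ¬ (1# + 1# ≈ 0#)

  InT : Carrier → Set ℓ
  InT k = ¬ (k ≈ 0#) × ¬ (k ≈ 1#) × ¬ (k ≈ - 1#)

  _↦_ : Carrier → Carrier → Set ℓ
  k₁ ↦ k₂ = ((1# + k₁) * (1# + k₁)) * (k₂ * k₂) ≈ (1# + 1# + 1# + 1#) * k₁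

  σ : Carrier → Carrier
  σ k = (1# - k) * ((1# + k) ⁻¹)

{-# OPTIONS --safe #-}

-- Put u = 1 + k, invertible because k ≠ -1.  Then σ k · u = 1 - k,
-- (1 + σ k) · u = 2 and (1 - σ k) · u = 2k.  As char K ≠ 2 these are
-- nonzero, so σ k avoids 0, -1 and 1; the last two also give
-- 1 - σ k = k (1 + σ k), i.e. σ (σ k) = k.  Multiplying the relation
-- σ k₂ ↦ σ k₁ by (u₁ u₂)² turns its two sides into 4 ((1 + k₁)² - 4 k₁) and
-- 4 ((1 + k₁)² - (1 + k₁)² k₂²), so it is equivalent to k₁ ↦ k₂.

module Submission where

open import Level using (Level)
open import Algebra.Bundles using (CommutativeRing)
open import Data.Nat.Base as ℕ using (zero; suc; z≤n)
import Data.Nat.Properties as ℕ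
open import Data.Integer.Base as ℤ using (ℤ; +_; -[1+_]; _⊖_; sign; ∣_∣; _◃_; 1ℤ)
import Data.Integer.Properties as ℤ
open import Data.Sign.Base as Sign using ()
import Data.Maybe.Base as Maybe
open import Data.Product.Base using (_×_; _,_)
open import Function.Base using (_∘_)
open import Function.Bundles using (_⇔_; mk⇔)
open import Function.Properties.Equivalence using (⇔-setoid)
open import Relation.Nullary.Negation using (¬_)
open import Relation.Nullary.Decidable using (dec⇒maybe)
open import Relation.Binary.Bundles using (Setoid)
open import Relation.Binary.PropositionalEquality.Core as ≡ using ()
open import Algebra.Solver.Ring.AlmostCommutativeRing
  using (fromCommutativeRing; _-Raw-AlmostCommutative⟶_)
import Algebra.Solver.Ring
import Algebra.Properties.Group
import Algebra.Properties.AbelianGroup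
import Algebra.Properties.Ring
import Algebra.Properties.CommutativeSemigroup
import Algebra.Properties.Semiring.Mult.TCOptimised
import Relation.Binary.Reasoning.Setoid
open import Defs

module SetoidEquivalences {a ℓ} (S : Setoid a ℓ) where
  open Setoid S

  ≈-sym-⇔ : ∀ {x y} → (x ≈ y) ⇔ (y ≈ x)
  ≈-sym-⇔ = mk⇔ sym sym

  ≈-resp-⇔ : ∀ {x x′ y y′} → x ≈ x′ → y ≈ y′ → (x ≈ y) ⇔ (x′ ≈ y′)
  ≈-resp-⇔ x≈x′ y≈y′ =
    mk⇔ (λ x≈y → trans (sym x≈x′) (trans x≈y y≈y′))
        (λ x′≈y′ → trans x≈x′ (trans x′≈y′ (sym y≈y′)))

module CommutativeRingProperties {c ℓ} (R : CommutativeRing c ℓ) where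
  open CommutativeRing R
  open Algebra.Properties.Group +-group using (∙-cancelˡ; ⁻¹-injective)
  open Algebra.Properties.AbelianGroup +-abelianGroup using (⁻¹-∙-comm)
  open Algebra.Properties.CommutativeSemigroup +-commutativeSemigroup
    using () renaming (interchange to +-interchange)
  open Relation.Binary.Reasoning.Setoid setoid

  [a+x]-[a+y]≈x-y : ∀ a x y → (a + x) - (a + y) ≈ x - y
  [a+x]-[a+y]≈x-y a x y = begin
    (a + x) - (a + y)       ≈⟨ +-congˡ (⁻¹-∙-comm a y) ⟨
    (a + x) + (- a + - y)   ≈⟨ +-interchange a x (- a) (- y) ⟩
    (a - a) + (x - y)       ≈⟨ +-congʳ (-‿inverseʳ a) ⟩
    0# + (x - y)            ≈⟨ +-identityˡ (x - y) ⟩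
    x - y                   ∎

  -‿cancelˡ-⇔ : ∀ {a x y} → (a - x ≈ a - y) ⇔ (x ≈ y)
  -‿cancelˡ-⇔ {a} = mk⇔ (λ a-x≈a-y → ⁻¹-injective (∙-cancelˡ a _ _ a-x≈a-y)) (+-congˡ ∘ -‿cong)

  *≈≉0⇒≉0 : ∀ {x u y} → x * u ≈ y → ¬ y ≈ 0# → ¬ x ≈ 0#
  *≈≉0⇒≉0 {x} {u} {y} xu≈y y≉0 x≈0 = y≉0 (begin
    y        ≈⟨ xu≈y ⟨
    x * u    ≈⟨ *-congʳ x≈0 ⟩
    0# * u   ≈⟨ zeroˡ u ⟩
    0#       ∎)

-- Algebra.Solver.Ring needs a coefficient ring mapped into R; the library
-- only provides ℕ coefficients, which cannot express subtraction.
module IntegerCoefficients {c ℓ} (R : CommutativeRing c ℓ) where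
  open CommutativeRing R hiding (zero)
  open Algebra.Properties.Semiring.Mult.TCOptimised semiring
    using (1+×; ×-homo-+; ×1-homo-*) renaming (_×_ to _×′_)
  open Algebra.Properties.Group +-group using (ε⁻¹≈ε; ⁻¹-involutive)
  open Algebra.Properties.AbelianGroup +-abelianGroup using (⁻¹-∙-comm)
  open Algebra.Properties.Ring ring using (-1*x≈-x)
  open Algebra.Properties.CommutativeSemigroup *-commutativeSemigroup
    using () renaming (interchange to *-interchange)
  open CommutativeRingProperties R using ([a+x]-[a+y]≈x-y)
  open Relation.Binary.Reasoning.Setoid setoid

  -- The type-checking-optimised _×′_ makes fromℤ (+ 1) = 1# and
  -- fromℤ (+ 4) = 1# + 1# + 1# + 1# hold definitionally, so integer
  -- constants in solver polynomials denote the usual numerals.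
  fromℤ : ℤ → Carrier
  fromℤ (+ n)      = n ×′ 1#
  fromℤ -[1+ n ]   = - (suc n ×′ 1#)

  fromℤ-homo-‿ : ∀ i → fromℤ (ℤ.- i) ≈ - fromℤ i
  fromℤ-homo-‿ (+ zero)  = sym ε⁻¹≈ε
  fromℤ-homo-‿ (+ suc n) = refl
  fromℤ-homo-‿ -[1+ n ]  = sym (⁻¹-involutive _)

  fromℤ-⊖ : ∀ m n → fromℤ (m ⊖ n) ≈ m ×′ 1# - n ×′ 1#
  fromℤ-⊖ zero n = begin
    fromℤ (0 ⊖ n)       ≡⟨ ≡.cong fromℤ (ℤ.⊖-≤ {0} {n} z≤n) ⟩
    fromℤ (ℤ.- (+ n))   ≈⟨ fromℤ-homo-‿ (+ n) ⟩
    - (n ×′ 1#)         ≈⟨ +-identityˡ _ ⟨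
    0# - n ×′ 1#        ∎
  fromℤ-⊖ (suc m) zero = begin
    fromℤ (suc m ⊖ 0)   ≡⟨ ≡.cong fromℤ (ℤ.⊖-≥ {suc m} {0} z≤n) ⟩
    suc m ×′ 1#         ≈⟨ +-identityʳ _ ⟨
    suc m ×′ 1# + 0#    ≈⟨ +-congˡ ε⁻¹≈ε ⟨
    suc m ×′ 1# - 0#    ∎
  fromℤ-⊖ (suc m) (suc n) = begin
    fromℤ (suc m ⊖ suc n)             ≡⟨ ≡.cong fromℤ (ℤ.[1+m]⊖[1+n]≡m⊖n m n) ⟩
    fromℤ (m ⊖ n)                     ≈⟨ fromℤ-⊖ m n ⟩
    m ×′ 1# - n ×′ 1#                 ≈⟨ [a+x]-[a+y]≈x-y 1# _ _ ⟨
    (1# + m ×′ 1#) - (1# + n ×′ 1#)   ≈⟨ +-cong (1+× m 1#) (-‿cong (1+× n 1#)) ⟨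
    suc m ×′ 1# - suc n ×′ 1#         ∎

  fromℤ-homo-+ : ∀ i j → fromℤ (i ℤ.+ j) ≈ fromℤ i + fromℤ j
  fromℤ-homo-+ -[1+ m ] -[1+ n ] = begin
    - (suc (suc (m ℕ.+ n)) ×′ 1#)     ≡⟨ ≡.cong (λ k → - (suc k ×′ 1#)) (ℕ.+-suc m n) ⟨
    - ((suc m ℕ.+ suc n) ×′ 1#)       ≈⟨ -‿cong (×-homo-+ 1# (suc m) (suc n)) ⟩
    - (suc m ×′ 1# + suc n ×′ 1#)     ≈⟨ ⁻¹-∙-comm _ _ ⟨
    fromℤ -[1+ m ] + fromℤ -[1+ n ]   ∎
  fromℤ-homo-+ -[1+ m ] (+ n)    = trans (fromℤ-⊖ n (suc m)) (+-comm _ _)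
  fromℤ-homo-+ (+ m)    -[1+ n ] = fromℤ-⊖ m (suc n)
  fromℤ-homo-+ (+ m)    (+ n)    = ×-homo-+ 1# m n

  fromℤ-◃ : ∀ s n → fromℤ (s ◃ n) ≈ fromℤ (s ◃ 1) * (n ×′ 1#)
  fromℤ-◃ s        zero    = sym (zeroʳ _)
  fromℤ-◃ Sign.+   (suc n) = sym (*-identityˡ _)
  fromℤ-◃ Sign.-   (suc n) = sym (-1*x≈-x _)

  fromℤ-sign-* : ∀ s t → fromℤ ((s Sign.* t) ◃ 1) ≈ fromℤ (s ◃ 1) * fromℤ (t ◃ 1)
  fromℤ-sign-* Sign.+ t      = sym (*-identityˡ _)
  fromℤ-sign-* Sign.- Sign.+ = sym (*-identityʳ _)
  fromℤ-sign-* Sign.- Sign.- = sym (trans (-1*x≈-x _) (⁻¹-involutive 1#))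

  fromℤ-homo-* : ∀ i j → fromℤ (i ℤ.* j) ≈ fromℤ i * fromℤ j
  fromℤ-homo-* i j = begin
    fromℤ ((s Sign.* t) ◃ (m ℕ.* n))
      ≈⟨ fromℤ-◃ (s Sign.* t) (m ℕ.* n) ⟩
    fromℤ ((s Sign.* t) ◃ 1) * ((m ℕ.* n) ×′ 1#)
      ≈⟨ *-cong (fromℤ-sign-* s t) (×1-homo-* m n) ⟩
    (fromℤ (s ◃ 1) * fromℤ (t ◃ 1)) * (m ×′ 1# * n ×′ 1#)
      ≈⟨ *-interchange _ _ _ _ ⟩
    (fromℤ (s ◃ 1) * m ×′ 1#) * (fromℤ (t ◃ 1) * n ×′ 1#)
      ≈⟨ *-cong (fromℤ-◃ s m) (fromℤ-◃ t n) ⟨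
    fromℤ (s ◃ m) * fromℤ (t ◃ n)
      ≡⟨ ≡.cong₂ (λ x y → fromℤ x * fromℤ y) (ℤ.◃-inverse i) (ℤ.◃-inverse j) ⟩
    fromℤ i * fromℤ j ∎
    where s = sign i; t = sign j; m = ∣ i ∣; n = ∣ j ∣

  fromℤ-homomorphism : ℤ.+-*-rawRing -Raw-AlmostCommutative⟶ fromCommutativeRing R
  fromℤ-homomorphism = record
    { ⟦_⟧    = fromℤ
    ; +-homo = fromℤ-homo-+
    ; *-homo = fromℤ-homo-*
    ; -‿homo = fromℤ-homo-‿
    ; 0-homo = refl
    ; 1-homo = refl
    }

  open Algebra.Solver.Ring ℤ.+-*-rawRing (fromCommutativeRing R) fromℤ-homomorphism
    (λ i j → Maybe.map (reflexive ∘ ≡.cong fromℤ) (dec⇒maybe (i ℤ.≟ j))) public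

module FieldProperties {c ℓ} (K : Field c ℓ) where
  open Field K
  open CommutativeRingProperties commutativeRing using (-‿cancelˡ-⇔)
  open SetoidEquivalences setoid
  module ≈-Reasoning = Relation.Binary.Reasoning.Setoid setoid
  module ⇔-Reasoning = Relation.Binary.Reasoning.Setoid (⇔-setoid ℓ)

  [x*u⁻¹]*u≈x : ∀ {u} → ¬ u ≈ 0# → ∀ x → (x * u ⁻¹) * u ≈ x
  [x*u⁻¹]*u≈x {u} u≉0 x = begin
    (x * u ⁻¹) * u   ≈⟨ *-assoc x (u ⁻¹) u ⟩
    x * (u ⁻¹ * u)   ≈⟨ *-congˡ (*-comm (u ⁻¹) u) ⟩
    x * (u * u ⁻¹)   ≈⟨ *-congˡ (⁻¹-inverseʳ u u≉0) ⟩
    x * 1#           ≈⟨ *-identityʳ x ⟩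
    x                ∎
    where open ≈-Reasoning

  *-cancelʳ : ∀ {u x y} → ¬ u ≈ 0# → x * u ≈ y * u → x ≈ y
  *-cancelʳ {u} {x} {y} u≉0 xu≈yu = begin
    x                ≈⟨ *-identityʳ x ⟨
    x * 1#           ≈⟨ *-congˡ (⁻¹-inverseʳ u u≉0) ⟨
    x * (u * u ⁻¹)   ≈⟨ *-assoc x u (u ⁻¹) ⟨
    (x * u) * u ⁻¹   ≈⟨ *-congʳ xu≈yu ⟩
    (y * u) * u ⁻¹   ≈⟨ *-assoc y u (u ⁻¹) ⟩
    y * (u * u ⁻¹)   ≈⟨ *-congˡ (⁻¹-inverseʳ u u≉0) ⟩
    y * 1#           ≈⟨ *-identityʳ y ⟩
    y                ∎
    where open ≈-Reasoning

  *-cancelʳ-⇔ : ∀ {u x y} → ¬ u ≈ 0# → (x * u ≈ y * u) ⇔ (x ≈ y)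
  *-cancelʳ-⇔ u≉0 = mk⇔ (*-cancelʳ u≉0) *-congʳ

  *-cancelˡ-⇔ : ∀ {u x y} → ¬ u ≈ 0# → (u * x ≈ u * y) ⇔ (x ≈ y)
  *-cancelˡ-⇔ {u} {x} {y} u≉0 =
    mk⇔ (λ ux≈uy → *-cancelʳ u≉0 (trans (*-comm x u) (trans ux≈uy (*-comm u y)))) *-congˡ

  *-≉0 : ∀ {x y} → ¬ x ≈ 0# → ¬ y ≈ 0# → ¬ x * y ≈ 0#
  *-≉0 {x} {y} x≉0 y≉0 xy≈0 = y≉0 (*-cancelʳ x≉0 (begin
    y * x    ≈⟨ *-comm y x ⟩
    x * y    ≈⟨ xy≈0 ⟩
    0#       ≈⟨ zeroˡ x ⟨
    0# * x   ∎))
    where open ≈-Reasoning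

  clear-denominators-⇔ : ∀ {m f x y c p q} → ¬ m ≈ 0# → ¬ f ≈ 0# →
                         x * m ≈ f * (c - q) → y * m ≈ f * (c - p) → (x ≈ y) ⇔ (p ≈ q)
  clear-denominators-⇔ {m} {f} {x} {y} {c} {p} {q} m≉0 f≉0 xm≈ ym≈ = begin
    (x ≈ y)                          ≈⟨ *-cancelʳ-⇔ m≉0 ⟨
    (x * m ≈ y * m)                  ≈⟨ ≈-resp-⇔ xm≈ ym≈ ⟩
    (f * (c - q) ≈ f * (c - p))      ≈⟨ *-cancelˡ-⇔ f≉0 ⟩
    (c - q ≈ c - p)                  ≈⟨ -‿cancelˡ-⇔ ⟩
    (q ≈ p)                          ≈⟨ ≈-sym-⇔ ⟩
    (p ≈ q)                          ∎
    where open ⇔-Reasoning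

module Involution {c ℓ} (K : Field c ℓ) (char≢2 : FieldDefs.CharNot2 K) where
  open Field K
  open FieldDefs K
  open FieldProperties K
  open CommutativeRingProperties commutativeRing using (*≈≉0⇒≉0)
  open IntegerCoefficients commutativeRing using (solve; _:=_; con; _:+_; _:*_; _:-_)
  open Algebra.Properties.Group +-group using (inverseʳ-unique; x∙y⁻¹≈ε⇒x≈y; x≈y⇒x∙y⁻¹≈ε)
  open Relation.Binary.Reasoning.Setoid setoid

  1+k≉0 : ∀ {k} → InT k → ¬ 1# + k ≈ 0#
  1+k≉0 (_ , _ , k≉-1) 1+k≈0 = k≉-1 (inverseʳ-unique 1# _ 1+k≈0)

  σ*[1+k] : ∀ {k} → ¬ 1# + k ≈ 0# → σ k * (1# + k) ≈ 1# - k
  σ*[1+k] {k} u≉0 = [x*u⁻¹]*u≈x u≉0 (1# - k)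

  [1+σ]*[1+k] : ∀ {k} → ¬ 1# + k ≈ 0# → (1# + σ k) * (1# + k) ≈ 1# + 1#
  [1+σ]*[1+k] {k} u≉0 = begin
    (1# + σ k) * (1# + k)
      ≈⟨ solve 2 (λ s u → (con 1ℤ :+ s) :* u := u :+ s :* u) refl (σ k) (1# + k) ⟩
    (1# + k) + σ k * (1# + k)
      ≈⟨ +-congˡ (σ*[1+k] u≉0) ⟩
    (1# + k) + (1# - k)
      ≈⟨ solve 1 (λ k → (con 1ℤ :+ k) :+ (con 1ℤ :- k) := con (+ 2)) refl k ⟩
    1# + 1# ∎

  [1-σ]*[1+k] : ∀ {k} → ¬ 1# + k ≈ 0# → (1# - σ k) * (1# + k) ≈ (1# + 1#) * k
  [1-σ]*[1+k] {k} u≉0 = begin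
    (1# - σ k) * (1# + k)
      ≈⟨ solve 2 (λ s u → (con 1ℤ :- s) :* u := u :- s :* u) refl (σ k) (1# + k) ⟩
    (1# + k) - σ k * (1# + k)
      ≈⟨ +-congˡ (-‿cong (σ*[1+k] u≉0)) ⟩
    (1# + k) - (1# - k)
      ≈⟨ solve 1 (λ k → (con 1ℤ :+ k) :- (con 1ℤ :- k) := con (+ 2) :* k) refl k ⟩
    (1# + 1#) * k ∎

  σ-InT : ∀ {k} → InT k → InT (σ k)
  σ-InT {k} t@(k≉0 , k≉1 , _) = σk≉0 , σk≉1 , σk≉-1
    where
    u≉0 : ¬ 1# + k ≈ 0#
    u≉0 = 1+k≉0 t
    σk≉0 : ¬ σ k ≈ 0#
    σk≉0 = *≈≉0⇒≉0 (σ*[1+k] u≉0) (λ 1-k≈0 → k≉1 (sym (x∙y⁻¹≈ε⇒x≈y 1# k 1-k≈0)))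
    σk≉1 : ¬ σ k ≈ 1#
    σk≉1 σk≈1 = *≈≉0⇒≉0 ([1-σ]*[1+k] u≉0) (*-≉0 char≢2 k≉0) (x≈y⇒x∙y⁻¹≈ε (sym σk≈1))
    σk≉-1 : ¬ σ k ≈ - 1#
    σk≉-1 σk≈-1 = *≈≉0⇒≉0 ([1+σ]*[1+k] u≉0) char≢2 (trans (+-congˡ σk≈-1) (-‿inverseʳ 1#))

  σ-involutive : ∀ {k} → InT k → σ (σ k) ≈ k
  σ-involutive {k} t = *-cancelʳ 1+σk≉0 (begin
    σ (σ k) * (1# + σ k)   ≈⟨ σ*[1+k] 1+σk≉0 ⟩
    1# - σ k               ≈⟨ *-cancelʳ u≉0 1-σk*u≈k*[1+σk]*u ⟩
    k * (1# + σ k)         ∎)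
    where
    u≉0 : ¬ 1# + k ≈ 0#
    u≉0 = 1+k≉0 t
    1+σk≉0 : ¬ 1# + σ k ≈ 0#
    1+σk≉0 = 1+k≉0 (σ-InT t)
    1-σk*u≈k*[1+σk]*u : (1# - σ k) * (1# + k) ≈ (k * (1# + σ k)) * (1# + k)
    1-σk*u≈k*[1+σk]*u = begin
      (1# - σ k) * (1# + k)        ≈⟨ [1-σ]*[1+k] u≉0 ⟩
      (1# + 1#) * k                ≈⟨ *-comm _ k ⟩
      k * (1# + 1#)                ≈⟨ *-congˡ ([1+σ]*[1+k] u≉0) ⟨
      k * ((1# + σ k) * (1# + k))  ≈⟨ *-assoc k _ _ ⟨
      (k * (1# + σ k)) * (1# + k)  ∎

  σ-↦-⇔ : ∀ {k₁ k₂} → InT k₁ → InT k₂ → (σ k₂ ↦ σ k₁) ⇔ (k₁ ↦ k₂)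
  σ-↦-⇔ {k₁} {k₂} t₁ t₂ = clear-denominators-⇔ M≉0 four≉0 lhs*M rhs*M
    where
    four u₁ u₂ C M lhs rhs : Carrier
    four = 1# + 1# + 1# + 1#
    u₁ = 1# + k₁
    u₂ = 1# + k₂
    C = u₁ * u₁
    M = (u₂ * u₂) * C
    lhs = ((1# + σ k₂) * (1# + σ k₂)) * (σ k₁ * σ k₁)
    rhs = four * σ k₂
    u₁≉0 : ¬ u₁ ≈ 0#
    u₁≉0 = 1+k≉0 t₁
    u₂≉0 : ¬ u₂ ≈ 0#
    u₂≉0 = 1+k≉0 t₂
    M≉0 : ¬ M ≈ 0#
    M≉0 = *-≉0 (*-≉0 u₂≉0 u₂≉0) (*-≉0 u₁≉0 u₁≉0)
    four≉0 : ¬ four ≈ 0#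
    four≉0 four≈0 = *-≉0 char≢2 char≢2
      (trans (solve 0 (con (+ 2) :* con (+ 2) := con (+ 4)) refl) four≈0)
    lhs*M : lhs * M ≈ four * (C - four * k₁)
    lhs*M = begin
      lhs * M
        ≈⟨ solve 4 (λ a b x y → ((a :* a) :* (b :* b)) :* ((y :* y) :* (x :* x))
                             := ((a :* y) :* (a :* y)) :* ((b :* x) :* (b :* x)))
                   refl (1# + σ k₂) (σ k₁) u₁ u₂ ⟩
      (((1# + σ k₂) * u₂) * ((1# + σ k₂) * u₂)) * ((σ k₁ * u₁) * (σ k₁ * u₁))
        ≈⟨ *-cong (*-cong ([1+σ]*[1+k] u₂≉0) ([1+σ]*[1+k] u₂≉0))
                  (*-cong (σ*[1+k] u₁≉0) (σ*[1+k] u₁≉0)) ⟩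
      ((1# + 1#) * (1# + 1#)) * ((1# - k₁) * (1# - k₁))
        ≈⟨ solve 1 (λ k → (con (+ 2) :* con (+ 2)) :* ((con 1ℤ :- k) :* (con 1ℤ :- k))
                       := con (+ 4) :* ((con 1ℤ :+ k) :* (con 1ℤ :+ k) :- con (+ 4) :* k))
                   refl k₁ ⟩
      four * (C - four * k₁) ∎
    rhs*M : rhs * M ≈ four * (C - C * (k₂ * k₂))
    rhs*M = begin
      rhs * M
        ≈⟨ solve 3 (λ s x y → (con (+ 4) :* s) :* ((y :* y) :* (x :* x))
                           := con (+ 4) :* ((s :* y) :* (y :* (x :* x))))
                   refl (σ k₂) u₁ u₂ ⟩
      four * ((σ k₂ * u₂) * (u₂ * C))
        ≈⟨ *-congˡ (*-congʳ (σ*[1+k] u₂≉0)) ⟩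
      four * ((1# - k₂) * (u₂ * C))
        ≈⟨ solve 2 (λ k c → con (+ 4) :* ((con 1ℤ :- k) :* ((con 1ℤ :+ k) :* c))
                         := con (+ 4) :* (c :- c :* (k :* k)))
                   refl k₂ C ⟩
      four * (C - C * (k₂ * k₂)) ∎

lemma5p1 : {c ℓ : Level} (K : Field c ℓ) →
    let open Field K in
    let open FieldDefs K in
    CharNot2 →
    ((k : Carrier) → InT k → InT (σ k)) ×
    ((k : Carrier) → InT k → σ (σ k) ≈ k) ×
    ((k₁ k₂ : Carrier) → InT k₁ → InT k₂ → ((σ k₂ ↦ σ k₁) ⇔ (k₁ ↦ k₂)))
lemma5p1 K char≢2 = (λ _ → σ-InT) , (λ _ → σ-involutive) , (λ _ _ → σ-↦-⇔)
  where open Involution K char≢2
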